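{- Let $(H,k,\chi)$ be an instance of Precoloring Extension where $H$ has at least one edge, and consider the $P_n\,|\,\mathrm{conc}\,|\,\sum C_j$ instance constructed from it as described in the context. Let $C$ be a minimal feasible schedule for it, let $j\in\{1,\ldots,n\}$, and let $J$ be the set of upper bound jobs of $j$. Then $\sum_{i\in J}C_i\ge (u_j+1)\cdot X^2$. Moreover, if $C(j)\in\{u_j+1,\ldots,X\}$, then $\sum_{i\in J}C_i\ge (u_j+1)\cdot X^2+X$.
   Context: Precoloring Extension instance: graph $H=(V,F)$, $V=\{1,\ldots,n\}$, integer $k$, and a proper coloring $\chi:V_0\to\{1,\ldots,k\}$ of $H[V_0]$, $V_0\subseteq V$. Scheduling: jobs with positive integer processing times $p_j$, release times $0$, conflict graph $G$; a schedule $C$ (completion times in $\mathbb{N}$) is feasible if $C_j-p_j\ge0$ for every job and $[C_i-p_i,C_i)\cap[C_j-p_j,C_j)=\emptyset$ for every edge $\{i,j\}$ of $G$; it is minimal if decreasing the completion time of any single job by any positive amount makes it infeasible. Construction: let $X=nk+1$; start with $G=H$, $p_j=1$ for $j\in V$. Let $u_j=\chi(j)$ for $j\in V_0$ and $u_j=k$ otherwise; $\ell_j=\chi(j)$ for $j\in V_0$ and $\ell_j=1$ otherwise. For each $j\in V$: add primary upper bound jobs $j(1),\ldots,j(X)$, each with processing time $X-u_j$, and edges $\{j,j(i)\}$; for each $i\in\{1,\ldots,X\}$ add secondary upper bound jobs $j(i,1),\ldots,j(i,X)$, each with processing time $u_j$, and edges $\{j(i),j(i,i_0)\}$ for $i_0\in\{1,\ldots,X\}$.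 The upper bound jobs of $j$ are its primary and secondary upper bound jobs. For each $j\in V_0$ with $\chi(j)>1$: add lower bound jobs $j^*(1),\ldots,j^*(X)$, each with processing time $\ell_j-1$, and edges $\{j,j^*(i)\}$. No other edges are added. -}

module Defs where

open import Data.Nat using (ℕ; zero; suc; _+_; _*_; _∸_; _≤_; _<_; _<ᵇ_)
open import Data.Fin using (Fin)
open import Data.Maybe using (Maybe; just; nothing)
open import Data.Bool using (Bool; false; T)
open import Data.Product using (_×_; ∃; ∃-syntax; Σ-syntax)
open import Data.Sum using (_⊎_)
open import Relation.Binary.PropositionalEquality using (_≡_; _≢_)
open import Relation.Nullary using (¬_)

Σ[<_]_ : (m : ℕ) → (Fin m → ℕ) → ℕ
Σ[< zero ] f = 0
Σ[< suc m ] f = f Fin.zero + Σ[< m ] (λ i → f (Fin.suc i))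

-- A Precoloring Extension instance: graph H on vertex set Fin n
-- (vertex i ∈ Fin n stands for vertex i+1 of {1,…,n}), edge relation E,
-- number of colours k, and a partial colouring χ (χ j ≡ nothing ⇔ j ∉ V₀).
record IsPrExt (n k : ℕ) (E : Fin n → Fin n → Set) (χ : Fin n → Maybe ℕ) : Set where
  field
    E-sym    : ∀ i j → E i j → E j i
    E-irrefl : ∀ i → ¬ E i i
    χ-range  : ∀ j c → χ j ≡ just c → 1 ≤ c × c ≤ k
    χ-proper : ∀ i j a b → E i j → χ i ≡ just a → χ j ≡ just b → a ≢ b

HasEdge : {n : ℕ} → (Fin n → Fin n → Set) → Set
HasEdge E = ∃[ i ] ∃[ j ] E i j

module Construction (n k : ℕ) (E : Fin n → Fin n → Set) (χ : Fin n → Maybe ℕ) where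

  X : ℕ
  X = n * k + 1

  u : Fin n → ℕ
  u j with χ j
  ... | just c  = c
  ... | nothing = k

  ℓ : Fin n → ℕ
  ℓ j with χ j
  ... | just c  = c
  ... | nothing = 1

  hasLow : Fin n → Bool
  hasLow j with χ j
  ... | just c  = 1 <ᵇ c
  ... | nothing = false

  data Job : Set where
    base : Fin n → Job
    prim : Fin n → Fin X → Job
    sec  : Fin n → Fin X → Fin X → Job
    low  : (j : Fin n) → T (hasLow j) → Fin X → Job

  p : Job → ℕ
  p (base j)     = 1
  p (prim j i)   = X ∸ u j
  p (sec j i i₀) = u j
  p (low j _ i)  = ℓ j ∸ 1

  data Edge : Job → Job → Set where
    e-H    : ∀ {i j} → E i j → Edge (base i) (base j)
    e-prim : ∀ {j i} → Edge (base j) (prim j i)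
    e-sec  : ∀ {j i i₀} → Edge (prim j i) (sec j i i₀)
    e-low  : ∀ {j h i} → Edge (base j) (low j h i)

  Conflict : Job → Job → Set
  Conflict a b = Edge a b ⊎ Edge b a

  Disjoint : (Job → ℕ) → Job → Job → Set
  Disjoint C a b = ¬ (Σ[ t ∈ ℕ ] ((C a ∸ p a ≤ t × t < C a) × (C b ∸ p b ≤ t × t < C b)))

  Feasible : (Job → ℕ) → Set
  Feasible C = (∀ a → p a ≤ C a) × (∀ a b → Conflict a b → Disjoint C a b)

  -- decreasing the completion time of any single job by any positive
  -- amount (staying in ℕ; going negative is trivially infeasible) breaks feasibility
  Minimal : (Job → ℕ) → Set
  Minimal C = ∀ a (C' : Job → ℕ) → (∀ b → b ≢ a → C' b ≡ C b) → C' a < C a → ¬ Feasible C'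

  upperSum : (Job → ℕ) → Fin n → ℕ
  upperSum C j = Σ[< X ] (λ i → C (prim j i)) + Σ[< X ] (λ i → Σ[< X ] (λ i₀ → C (sec j i i₀)))

-- Fix j, write U = u j and group the upper bound jobs of j into the X blocks
-- {j(i)} ∪ {j(i,i₀) | i₀}.  The primary job j(i) has length X − U, so if it
-- completes before X it starts before U; then no secondary job j(i,i₀), of
-- length U, can run before j(i), so all X of them complete at X or later.
-- Either way a block contributes at least X + X·U, and X blocks give
-- X·(X + X·U) = (U + 1)·X².  If moreover j itself runs in [U, X), then j(i)
-- cannot occupy [U, X) exactly, i.e. it does not complete at X, and each block
-- gains one more unit.
module Submission where

open import Defs
open import Algebra.Properties.CommutativeSemigroup using (interchange)
open import Data.Fin using (Fin)
open import Data.Fin.Properties using (nonZeroIndex)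
open import Data.Maybe using (Maybe; just; nothing)
open import Data.Nat using (ℕ; zero; suc; _+_; _*_; _∸_; _⊔_; _≤_; _<_; _≤?_; z≤n; s≤s)
open import Data.Nat.Properties
open import Data.Nat.Tactic.RingSolver using (solve-∀)
open import Data.Product using (_×_; _,_; proj₁; proj₂; Σ-syntax)
open import Data.Sum using (_⊎_; inj₁; inj₂; [_,_])
open import Relation.Binary.Definitions using (tri<; tri≈; tri>)
open import Relation.Binary.PropositionalEquality
  using (_≡_; _≢_; refl; sym; cong; subst; module ≡-Reasoning)
open import Relation.Nullary using (¬_; yes; no; contradiction)

Σ[<]-distrib-+ : ∀ m (f g : Fin m → ℕ) →
  Σ[< m ] (λ i → f i + g i) ≡ Σ[< m ] f + Σ[< m ] g
Σ[<]-distrib-+ zero    f g = refl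
Σ[<]-distrib-+ (suc m) f g = begin
  (f Fin.zero + g Fin.zero) + Σ[< m ] (λ i → f (Fin.suc i) + g (Fin.suc i))
    ≡⟨ cong (f Fin.zero + g Fin.zero +_) (Σ[<]-distrib-+ m (λ i → f (Fin.suc i)) (λ i → g (Fin.suc i))) ⟩
  (f Fin.zero + g Fin.zero) + (Σ[< m ] (λ i → f (Fin.suc i)) + Σ[< m ] (λ i → g (Fin.suc i)))
    ≡⟨ interchange +-commutativeSemigroup (f Fin.zero) (g Fin.zero) _ _ ⟩
  Σ[< suc m ] f + Σ[< suc m ] g ∎
  where open ≡-Reasoning

Σ[<]-lowerBound : ∀ m {c} (f : Fin m → ℕ) → (∀ i → c ≤ f i) → m * c ≤ Σ[< m ] f
Σ[<]-lowerBound zero    f c≤f = z≤n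
Σ[<]-lowerBound (suc m) f c≤f =
  +-mono-≤ (c≤f Fin.zero) (Σ[<]-lowerBound m (λ i → f (Fin.suc i)) (λ i → c≤f (Fin.suc i)))

IntervalsDisjoint : ℕ → ℕ → ℕ → ℕ → Set
IntervalsDisjoint a b c d = ¬ (Σ[ t ∈ ℕ ] ((a ≤ t × t < b) × (c ≤ t × t < d)))

disjoint⇒ordered : ∀ {a b c d} → a < b → c < d →
  IntervalsDisjoint a b c d → b ≤ c ⊎ d ≤ a
disjoint⇒ordered {a} {b} {c} {d} a<b c<d disjoint with b ≤? c | d ≤? a
... | yes b≤c | _       = inj₁ b≤c
... | no _    | yes d≤a = inj₂ d≤a
... | no b≰c  | no d≰a  = contradiction
  (a ⊔ c , (m≤m⊔n a c , ⊔-lub a<b (≰⇒> b≰c)) , (m≤n⊔m a c , ⊔-lub (≰⇒> d≰a) c<d))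
  disjoint

module PrimaryBlock {U X : ℕ} (1≤U : 1 ≤ U) (U<X : U < X)
  {cp : ℕ} (cs : Fin X → ℕ) (D≤cp : X ∸ U ≤ cp) (U≤cs : ∀ i → U ≤ cs i)
  (disjoint : ∀ i → IntervalsDisjoint (cp ∸ (X ∸ U)) cp (cs i ∸ U) (cs i)) where

  private
    D = X ∸ U

    0<D : 0 < D
    0<D = m<n⇒0<n∸m U<X

    X+X*U≤X*X : X + X * U ≤ X * X
    X+X*U≤X*X = subst (_≤ X * X) (*-suc X U) (*-monoʳ-≤ X U<X)

  secondaries-late : cp < X → ∀ i → X ≤ cs i
  secondaries-late cp<X i
    with disjoint⇒ordered (∸-monoʳ-< 0<D D≤cp) (∸-monoʳ-< 1≤U (U≤cs i)) (disjoint i)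
  ... | inj₁ cp≤cs∸U = begin
    X      ≡⟨ m∸n+n≡m (<⇒≤ U<X) ⟨
    D + U  ≤⟨ +-monoˡ-≤ U D≤cp ⟩
    cp + U ≤⟨ m≤o∸n⇒m+n≤o cp (U≤cs i) cp≤cs∸U ⟩
    cs i   ∎
    where open ≤-Reasoning
  ... | inj₂ cs≤cp∸D = contradiction start<U (≤⇒≯ (U≤cs i))
    where
    start<U : cs i < U
    start<U = begin-strict
      cs i   ≤⟨ cs≤cp∸D ⟩
      cp ∸ D <⟨ ∸-monoˡ-< cp<X D≤cp ⟩
      X ∸ D  ≡⟨ m∸[m∸n]≡n (<⇒≤ U<X) ⟩
      U      ∎
      where open ≤-Reasoning

  private
    X*X≤Σcs : cp < X → X * X ≤ Σ[< X ] cs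
    X*X≤Σcs cp<X = Σ[<]-lowerBound X cs (secondaries-late cp<X)

  block-≥ : X + X * U ≤ cp + Σ[< X ] cs
  block-≥ with X ≤? cp
  ... | yes X≤cp = +-mono-≤ X≤cp (Σ[<]-lowerBound X cs U≤cs)
  ... | no X≰cp  = begin
    X + X * U       ≤⟨ X+X*U≤X*X ⟩
    X * X           ≤⟨ X*X≤Σcs (≰⇒> X≰cp) ⟩
    Σ[< X ] cs      ≤⟨ m≤n+m _ cp ⟩
    cp + Σ[< X ] cs ∎
    where open ≤-Reasoning

  block-> : cp ≢ X → X + X * U < cp + Σ[< X ] cs
  block-> cp≢X with <-cmp cp X
  ... | tri≈ _ cp≡X _ = contradiction cp≡X cp≢X
  ... | tri> _ _ X<cp = +-mono-<-≤ X<cp (Σ[<]-lowerBound X cs U≤cs)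
  ... | tri< cp<X _ _ = begin-strict
    X + X * U       ≤⟨ X+X*U≤X*X ⟩
    X * X           ≤⟨ X*X≤Σcs cp<X ⟩
    Σ[< X ] cs      <⟨ m<n+m _ (≤-trans 0<D D≤cp) ⟩
    cp + Σ[< X ] cs ∎
    where open ≤-Reasoning

-- A unit job completing at cb ∈ (U, X] lies inside [U, X), which is exactly
-- where a job of length X ∸ U completing at X would run.
primaryEnd≢X : ∀ {U X cb cp} → U < X → U < cb → cb ≤ X →
  IntervalsDisjoint (cb ∸ 1) cb (cp ∸ (X ∸ U)) cp → cp ≢ X
primaryEnd≢X {U} {X} {cb} U<X U<cb cb≤X disjoint refl =
  [ (λ cb≤X∸D → <⇒≱ U<cb (≤-trans cb≤X∸D (≤-reflexive X∸D≡U)))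
  , (λ X≤cb∸1 → <⇒≱ (≤-<-trans X≤cb∸1 cb∸1<cb) cb≤X)
  ] (disjoint⇒ordered cb∸1<cb (subst (_< X) (sym X∸D≡U) U<X) disjoint)
  where
  X∸D≡U : X ∸ (X ∸ U) ≡ U
  X∸D≡U = m∸[m∸n]≡n (<⇒≤ U<X)
  cb∸1<cb : cb ∸ 1 < cb
  cb∸1<cb = ∸-monoʳ-< (s≤s z≤n) (≤-trans (s≤s z≤n) U<cb)

module UpperBounds (n k : ℕ) (E : Fin n → Fin n → Set) (χ : Fin n → Maybe ℕ)
  (instance-ok : IsPrExt n k E χ) (1≤k : 1 ≤ k) where
  open Construction n k E χ

  1≤u×u≤k : ∀ j → 1 ≤ u j × u j ≤ k
  1≤u×u≤k j with χ j in χj≡c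
  ... | just c  = IsPrExt.χ-range instance-ok j c χj≡c
  ... | nothing = 1≤k , ≤-refl

  u<X : ∀ j → u j < X
  u<X j = begin-strict
    u j   ≤⟨ proj₂ (1≤u×u≤k j) ⟩
    k     ≤⟨ m≤n*m k n {{nonZeroIndex j}} ⟩
    n * k <⟨ m<m+n (n * k) (s≤s z≤n) ⟩
    X     ∎
    where open ≤-Reasoning

  module Schedule (C : Job → ℕ) (feasible : Feasible C) (j : Fin n) where
    private
      p≤C = proj₁ feasible
      disjoint = proj₂ feasible

    block : Fin X → ℕ
    block i = C (prim j i) + Σ[< X ] (λ i₀ → C (sec j i i₀))

    upperSum≡Σblock : upperSum C j ≡ Σ[< X ] block
    upperSum≡Σblock = sym (Σ[<]-distrib-+ X _ _)

    module Block (i : Fin X) = PrimaryBlock (proj₁ (1≤u×u≤k j)) (u<X j)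
      (λ i₀ → C (sec j i i₀)) (p≤C (prim j i)) (λ i₀ → p≤C (sec j i i₀))
      (λ i₀ → disjoint (prim j i) (sec j i i₀) (inj₁ e-sec))

    primaryEnd≢X-if-base-late : u j + 1 ≤ C (base j) → C (base j) ≤ X →
      ∀ i → C (prim j i) ≢ X
    primaryEnd≢X-if-base-late u+1≤b b≤X i =
      primaryEnd≢X (u<X j) (subst (_≤ C (base j)) (+-comm (u j) 1) u+1≤b) b≤X
        (disjoint (base j) (prim j i) (inj₁ e-prim))

lemma12 : (n k : ℕ) (E : Fin n → Fin n → Set) (χ : Fin n → Maybe ℕ) →
    IsPrExt n k E χ → 1 ≤ k → HasEdge E →
    let open Construction n k E χ in
    (C : Job → ℕ) → Feasible C → Minimal C → (j : Fin n) →
    ((u j + 1) * (X * X) ≤ upperSum C j)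
    × (u j + 1 ≤ C (base j) → C (base j) ≤ X → (u j + 1) * (X * X) + X ≤ upperSum C j)
lemma12 n k E χ instance-ok 1≤k _ C feasible _ j = lower , lower-strict
  where
  open Construction n k E χ
  open UpperBounds n k E χ instance-ok 1≤k
  open Schedule C feasible j

  X-blocks : ∀ U X → (U + 1) * (X * X) ≡ X * (X + X * U)
  X-blocks = solve-∀

  X-blocks-suc : ∀ U X → (U + 1) * (X * X) + X ≡ X * suc (X + X * U)
  X-blocks-suc = solve-∀

  lower : (u j + 1) * (X * X) ≤ upperSum C j
  lower = begin
    (u j + 1) * (X * X) ≡⟨ X-blocks (u j) X ⟩
    X * (X + X * u j)   ≤⟨ Σ[<]-lowerBound X block (λ i → Block.block-≥ i) ⟩
    Σ[< X ] block       ≡⟨ upperSum≡Σblock ⟨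
    upperSum C j        ∎
    where open ≤-Reasoning

  lower-strict : u j + 1 ≤ C (base j) → C (base j) ≤ X → (u j + 1) * (X * X) + X ≤ upperSum C j
  lower-strict u+1≤b b≤X = begin
    (u j + 1) * (X * X) + X ≡⟨ X-blocks-suc (u j) X ⟩
    X * suc (X + X * u j)   ≤⟨ Σ[<]-lowerBound X block
                                 (λ i → Block.block-> i (primaryEnd≢X-if-base-late u+1≤b b≤X i)) ⟩
    Σ[< X ] block           ≡⟨ upperSum≡Σblock ⟨
    upperSum C j            ∎
    where open ≤-Reasoning
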